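{- Let $G$ be Hofstadter's G-sequence and let $W$ be the Wythoff swap sequence (both defined below). Define $\overline{W}(n)=\frac{1}{n+1}\sum_{i=0}^{n}W(i)$ for $n\ge 0$. Then $\overline{W}(n)=G(n)$ for all $n\ge 0$.
   Context: Hofstadter's G-sequence is defined by $G(0)=0$, $G(1)=1$, and $G(n)=n-G(G(n-1))$ for $n\ge 2$. Let $\varphi=(1+\sqrt5)/2$. The lower and upper Wythoff sequences are $L(n)=\lfloor n\varphi\rfloor$ and $U(n)=\lfloor n\varphi^2\rfloor$ for $n\ge 1$; the sets $\{L(n):n\ge1\}$ and $\{U(n):n\ge1\}$ are disjoint with union the set of positive integers. The Wythoff swap sequence $W$ on the nonnegative integers is defined by $W(0)=0$ and $W(L(n))=U(n)$, $W(U(n))=L(n)$ for all $n\ge 1$. -}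

module Defs where

open import Data.Nat using (ℕ; zero; suc; _+_; _*_; _∸_; _^_; _≤_; _<_)
open import Data.Product using (_×_)
open import Relation.Binary.PropositionalEquality using (_≡_)

-- Since φ = (1+√5)/2 and φ² = (3+√5)/2 are irrational, for n ≥ 1 and m ∈ ℕ:
--   m ≤ nφ   ⇔ 2m - n ≤ n√5   ⇔ (2m ∸ n)²  ≤ 5n²
--   m ≤ nφ²  ⇔ 2m - 3n ≤ n√5  ⇔ (2m ∸ 3n)² ≤ 5n²
-- and nφ < m ⇔ 5n² < (2m ∸ n)², nφ² < m ⇔ 5n² < (2m ∸ 3n)².
LeNPhi : ℕ → ℕ → Set
LeNPhi n m = (2 * m ∸ n) ^ 2 ≤ 5 * n ^ 2

LtNPhi : ℕ → ℕ → Set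
LtNPhi n m = 5 * n ^ 2 < (2 * m ∸ n) ^ 2

LeNPhi² : ℕ → ℕ → Set
LeNPhi² n m = (2 * m ∸ 3 * n) ^ 2 ≤ 5 * n ^ 2

LtNPhi² : ℕ → ℕ → Set
LtNPhi² n m = 5 * n ^ 2 < (2 * m ∸ 3 * n) ^ 2

IsFloorNPhi : ℕ → ℕ → Set
IsFloorNPhi n m = LeNPhi n m × LtNPhi n (suc m)

IsFloorNPhi² : ℕ → ℕ → Set
IsFloorNPhi² n m = LeNPhi² n m × LtNPhi² n (suc m)

IsLowerWythoff : (ℕ → ℕ) → Set
IsLowerWythoff L = ∀ n → 1 ≤ n → IsFloorNPhi n (L n)

IsUpperWythoff : (ℕ → ℕ) → Set
IsUpperWythoff U = ∀ n → 1 ≤ n → IsFloorNPhi² n (U n)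

IsWythoffSwap : (ℕ → ℕ) → (ℕ → ℕ) → (ℕ → ℕ) → Set
IsWythoffSwap L U W =
  (W 0 ≡ 0) × (∀ n → 1 ≤ n → (W (L n) ≡ U n) × (W (U n) ≡ L n))

IsHofstadterG : (ℕ → ℕ) → Set
IsHofstadterG G =
  (G 0 ≡ 0) × (G 1 ≡ 1) × (∀ n → G (suc (suc n)) + G (G (suc n)) ≡ suc (suc n))

sumTo : (ℕ → ℕ) → ℕ → ℕ
sumTo f zero = f 0
sumTo f (suc n) = sumTo f n + f (suc n)

{-# OPTIONS --safe #-}
-- G n = ⌊(n + 1)/φ⌋: the map N ↦ ⌊N/φ⌋ obeys G's recurrence, because φ − 1 = 1/φ turns ⌊cφ⌋
-- into c + ⌊c/φ⌋. Hence G steps by 0 or 1, and (n + 2) G (n + 1) − (n + 1) G n is G n when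
-- n + 1 = U j with j = n + 1 − G n (so W (n + 1) = L j = G n), and n + 2 + G n when
-- n + 1 = L (G n + 1) (so W (n + 1) = U (G n + 1)); summing gives the theorem. All comparisons
-- with multiples of φ are done in ℕ, the irrationality of φ ruling out equality.
module Submission where

open import Defs
open import Data.Nat using (ℕ; zero; suc; _+_; _*_; _∸_; _^_; _≤_; _<_; z≤n; s≤s; s≤s⁻¹; z<s; _≤?_)
open import Data.Nat.Properties
open import Data.Nat.Induction using (<-rec)
open import Data.Nat.Tactic.RingSolver using (solve-∀)
open import Data.Product using (∃; _×_; _,_; proj₁; proj₂)
open import Data.Sum using (_⊎_; inj₁; inj₂; [_,_]′)
open import Function using (id)
open import Relation.Nullary using (yes; no; contradiction)
open import Relation.Binary using (tri<; tri≈; tri>)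
open import Relation.Binary.PropositionalEquality

m≤n⇒∃[o]o+m≡n : ∀ {m n} → m ≤ n → ∃ λ o → o + m ≡ n
m≤n⇒∃[o]o+m≡n m≤n = _ , m∸n+n≡m m≤n

m*m<n*n⇒m<n : ∀ {m n} → m * m < n * n → m < n
m*m<n*n⇒m<n h = ≰⇒> (λ n≤m → <⇒≱ h (*-mono-≤ n≤m n≤m))

private
  square-+ : ∀ x y → (x + y) * (x + y) ≡ (x * x + 2 * (x * y)) + y * y
  square-+ = solve-∀

  k*square-+ : ∀ k y z → k * ((y + z) * (y + z)) ≡ (k * (y * y) + 2 * (k * (y * z))) + k * (z * z)
  k*square-+ = solve-∀

  square-* : ∀ x y → (x * x) * (y * y) ≡ (x * y) * (x * y)
  square-* = solve-∀

  k*square-* : ∀ k y z → (k * (y * y)) * (k * (z * z)) ≡ (k * (y * z)) * (k * (y * z))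
  k*square-* = solve-∀

module _ {k x₁ y₁ x₂ y₂ : ℕ} where

  -- Read as x < y √k; the cross term x₁ x₂ < k y₁ y₂ is the product of the two hypotheses, square-rooted.
  x²<ky²-+ : x₁ * x₁ < k * (y₁ * y₁) → x₂ * x₂ < k * (y₂ * y₂)
           → (x₁ + x₂) * (x₁ + x₂) < k * ((y₁ + y₂) * (y₁ + y₂))
  x²<ky²-+ h₁ h₂ = subst₂ _<_ (sym (square-+ x₁ x₂)) (sym (k*square-+ k y₁ y₂))
    (+-mono-< (+-mono-< h₁ (*-monoʳ-< 2 cross)) h₂)
    where
    cross : x₁ * x₂ < k * (y₁ * y₂)
    cross = m*m<n*n⇒m<n (subst₂ _<_ (square-* x₁ x₂) (k*square-* k y₁ y₂) (*-mono-< h₁ h₂))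

  ky²<x²-+ : k * (y₁ * y₁) < x₁ * x₁ → k * (y₂ * y₂) < x₂ * x₂
           → k * ((y₁ + y₂) * (y₁ + y₂)) < (x₁ + x₂) * (x₁ + x₂)
  ky²<x²-+ h₁ h₂ = subst₂ _<_ (sym (k*square-+ k y₁ y₂)) (sym (square-+ x₁ x₂))
    (+-mono-< (+-mono-< h₁ (*-monoʳ-< 2 cross)) h₂)
    where
    cross : k * (y₁ * y₂) < x₁ * x₂
    cross = m*m<n*n⇒m<n (subst₂ _<_ (k*square-* k y₁ y₂) (square-* x₁ x₂) (*-mono-< h₁ h₂))

-- a ·φ< b and a ·φ> b say a φ < b and a φ > b: as φ² = φ + 1, a φ < b ⇔ a² + a b < b².
infix 4 _·φ<_ _·φ>_

data _·φ<_ (a b : ℕ) : Set where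
  mk·φ< : a * a + a * b < b * b → a ·φ< b

data _·φ>_ (a b : ℕ) : Set where
  mk·φ> : b * b < a * a + a * b → a ·φ> b

0·φ<1 : 0 ·φ< 1
0·φ<1 = mk·φ< (n<1+n 0)

1·φ<2 : 1 ·φ< 2
1·φ<2 = mk·φ< (n<1+n 3)

1·φ>1 : 1 ·φ> 1
1·φ>1 = mk·φ> (n<1+n 1)

2·φ>2 : 2 ·φ> 2
2·φ>2 = mk·φ> (m<m+n 4 z<s)

private
  [2a+b]² : ∀ a b → (2 * a + b) * (2 * a + b) ≡ 4 * (a * a + a * b) + b * b
  [2a+b]² = solve-∀

  5b² : ∀ b → 5 * (b * b) ≡ 4 * (b * b) + b * b
  5b² = solve-∀

  regroup : ∀ a₁ b₁ a₂ b₂ → 2 * (a₁ + a₂) + (b₁ + b₂) ≡ (2 * a₁ + b₁) + (2 * a₂ + b₂)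
  regroup = solve-∀

module _ {a b : ℕ} where

  a·φ<b⇒[2a+b]²<5b² : a ·φ< b → (2 * a + b) * (2 * a + b) < 5 * (b * b)
  a·φ<b⇒[2a+b]²<5b² (mk·φ< h) = subst₂ _<_ (sym ([2a+b]² a b)) (sym (5b² b)) (+-monoˡ-< (b * b) (*-monoʳ-< 4 h))

  [2a+b]²<5b²⇒a·φ<b : (2 * a + b) * (2 * a + b) < 5 * (b * b) → a ·φ< b
  [2a+b]²<5b²⇒a·φ<b h = mk·φ< (*-cancelˡ-< 4 _ _ (+-cancelʳ-< (b * b) _ _ (subst₂ _<_ ([2a+b]² a b) (5b² b) h)))

  a·φ>b⇒5b²<[2a+b]² : a ·φ> b → 5 * (b * b) < (2 * a + b) * (2 * a + b)
  a·φ>b⇒5b²<[2a+b]² (mk·φ> h) = subst₂ _<_ (sym (5b² b)) (sym ([2a+b]² a b)) (+-monoˡ-< (b * b) (*-monoʳ-< 4 h))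

  5b²<[2a+b]²⇒a·φ>b : 5 * (b * b) < (2 * a + b) * (2 * a + b) → a ·φ> b
  5b²<[2a+b]²⇒a·φ>b h = mk·φ> (*-cancelˡ-< 4 _ _ (+-cancelʳ-< (b * b) _ _ (subst₂ _<_ (5b² b) ([2a+b]² a b) h)))

module _ {a₁ b₁ a₂ b₂ : ℕ} where

  ·φ<-+ : a₁ ·φ< b₁ → a₂ ·φ< b₂ → (a₁ + a₂) ·φ< (b₁ + b₂)
  ·φ<-+ h₁ h₂ = [2a+b]²<5b²⇒a·φ<b (subst (λ x → x * x < 5 * ((b₁ + b₂) * (b₁ + b₂))) (sym (regroup a₁ b₁ a₂ b₂))
    (x²<ky²-+ {5} {2 * a₁ + b₁} {b₁} {2 * a₂ + b₂} {b₂} (a·φ<b⇒[2a+b]²<5b² h₁) (a·φ<b⇒[2a+b]²<5b² h₂)))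

  ·φ>-+ : a₁ ·φ> b₁ → a₂ ·φ> b₂ → (a₁ + a₂) ·φ> (b₁ + b₂)
  ·φ>-+ h₁ h₂ = 5b²<[2a+b]²⇒a·φ>b (subst (λ x → 5 * ((b₁ + b₂) * (b₁ + b₂)) < x * x) (sym (regroup a₁ b₁ a₂ b₂))
    (ky²<x²-+ {5} {2 * a₁ + b₁} {b₁} {2 * a₂ + b₂} {b₂} (a·φ>b⇒5b²<[2a+b]² h₁) (a·φ>b⇒5b²<[2a+b]² h₂)))

a·φ<b⇒a·φ<1+b : ∀ {a b} → a ·φ< b → a ·φ< suc b
a·φ<b⇒a·φ<1+b {a} {b} h = subst₂ _·φ<_ (+-identityʳ a) (+-comm b 1) (·φ<-+ h 0·φ<1)

a·φ>b⇒1+a·φ>1+b : ∀ {a b} → a ·φ> b → suc a ·φ> suc b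
a·φ>b⇒1+a·φ>1+b h = ·φ>-+ 1·φ>1 h

a·φ<b⇒a<b : ∀ {a b} → a ·φ< b → a < b
a·φ<b⇒a<b {a} {b} (mk·φ< h) = ≰⇒> (λ b≤a → <⇒≱ h (≤-trans (*-mono-≤ b≤a b≤a) (m≤m+n (a * a) (a * b))))

·φ<-antimonoˡ : ∀ {a a′ b} → a′ ≤ a → a ·φ< b → a′ ·φ< b
·φ<-antimonoˡ a′≤a (mk·φ< h) = mk·φ< (≤-<-trans (+-mono-≤ (*-mono-≤ a′≤a a′≤a) (*-monoˡ-≤ _ a′≤a)) h)

·φ<∧·φ>⇒≤ : ∀ {a a′ b} → a ·φ< b → suc a′ ·φ> b → a ≤ a′
·φ<∧·φ>⇒≤ {a} {a′} h (mk·φ> g) with a ≤? a′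
... | yes a≤a′ = a≤a′
... | no a≰a′ with ·φ<-antimonoˡ (≰⇒> a≰a′) h
...   | mk·φ< h′ = contradiction g (<-asym h′)

private
  c[c+r] : ∀ c r → c * c + c * (r + c) ≡ (c * c + c * r) + c * c
  c[c+r] = solve-∀

  [r+c]² : ∀ c r → (r + c) * (r + c) ≡ (c * c + c * r) + (r * r + r * c)
  [r+c]² = solve-∀

-- Since φ − 1 = 1/φ, c φ > r + c iff c > r φ.
c·φ>r+c⇒r·φ<c : ∀ {c r} → c ·φ> (r + c) → r ·φ< c
c·φ>r+c⇒r·φ<c {c} {r} (mk·φ> h) = mk·φ< (+-cancelˡ-< (c * c + c * r) _ _ (subst₂ _<_ ([r+c]² c r) (c[c+r] c r) h))

c·φ<r+c⇒r·φ>c : ∀ {c r} → c ·φ< (r + c) → r ·φ> c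
c·φ<r+c⇒r·φ>c {c} {r} (mk·φ< h) = mk·φ> (+-cancelˡ-< (c * c + c * r) _ _ (subst₂ _<_ (c[c+r] c r) ([r+c]² c r) h))

-- Irrationality of φ, by the descent (a, b) ↦ (b − a, a) on solutions of a² + a b = b².
a²+ab≡b²⇒b≡0 : ∀ b a → a * a + a * b ≡ b * b → b ≡ 0
a²+ab≡b²⇒b≡0 = <-rec _ descend
  where
  b*b≡0⇒b≡0 : ∀ {b} → b * b ≡ 0 → b ≡ 0
  b*b≡0⇒b≡0 {b} e = [ id , id ]′ (m*n≡0⇒m≡0∨n≡0 b e)

  descend : ∀ b → (∀ {c} → c < b → ∀ a → a * a + a * c ≡ c * c → c ≡ 0)
          → ∀ a → a * a + a * b ≡ b * b → b ≡ 0
  descend b ih a e with b ≤? a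
  ... | yes b≤a = b*b≡0⇒b≡0 (n≤0⇒n≡0 (+-cancelˡ-≤ (b * b) _ 0 (begin
          b * b + b * b ≤⟨ +-mono-≤ (*-mono-≤ b≤a b≤a) (*-monoˡ-≤ b b≤a) ⟩
          a * a + a * b ≡⟨ e ⟩
          b * b         ≡⟨ +-identityʳ (b * b) ⟨
          b * b + 0     ∎)))
    where open ≤-Reasoning
  ... | no b≰a with m≤n⇒∃[o]o+m≡n (<⇒≤ (≰⇒> b≰a))
  ...   | d , refl with ih (≰⇒> b≰a) d (+-cancelˡ-≡ (a * a + a * d) _ _ (begin
          (a * a + a * d) + (d * d + d * a) ≡⟨ [r+c]² a d ⟨
          (d + a) * (d + a)                 ≡⟨ e ⟨
          a * a + a * (d + a)               ≡⟨ c[c+r] a d ⟩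
          (a * a + a * d) + a * a           ∎))
    where open ≡-Reasoning
  ...     | refl = b*b≡0⇒b≡0 (sym e)

·φ<⊎·φ> : ∀ a b → a ·φ< suc b ⊎ a ·φ> suc b
·φ<⊎·φ> a b with <-cmp (a * a + a * suc b) (suc b * suc b)
... | tri< lt _ _ = inj₁ (mk·φ< lt)
... | tri≈ _ e _ = contradiction (a²+ab≡b²⇒b≡0 (suc b) a e) λ ()
... | tri> _ _ gt = inj₂ (mk·φ> gt)

⌊_/φ⌋≡_ : ℕ → ℕ → Set
⌊ m /φ⌋≡ k = k ·φ< m × suc k ·φ> m

⌊_·φ⌋≡_ : ℕ → ℕ → Set
⌊ c ·φ⌋≡ m = c ·φ> m × c ·φ< suc m

⌊/φ⌋-unique : ∀ {m k k′} → ⌊ m /φ⌋≡ k → ⌊ m /φ⌋≡ k′ → k ≡ k′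
⌊/φ⌋-unique (k· , k+1·) (k′· , k′+1·) = ≤-antisym (·φ<∧·φ>⇒≤ k· k′+1·) (·φ<∧·φ>⇒≤ k′· k+1·)

⌊/φ⌋-suc : ∀ {m k} → ⌊ m /φ⌋≡ k → ⌊ suc m /φ⌋≡ k ⊎ ⌊ suc m /φ⌋≡ suc k
⌊/φ⌋-suc {m} {k} (k· , k+1·) with ·φ<⊎·φ> (suc k) m
... | inj₁ k+1·< = inj₂ (k+1·< , a·φ>b⇒1+a·φ>1+b k+1·)
... | inj₂ k+1·> = inj₁ (a·φ<b⇒a·φ<1+b k· , k+1·>)

⌊·φ⌋-complement : ∀ {c r} → ⌊ c ·φ⌋≡ (r + c) → ⌊ c /φ⌋≡ r
⌊·φ⌋-complement (c·> , c·<) = c·φ>r+c⇒r·φ<c c·> , c·φ<r+c⇒r·φ>c c·<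

-- With c = m + 1, ⌊cφ⌋ is N + 1 or N according as ⌊(N + 1)/φ⌋ is m or m + 1, and p = ⌊cφ⌋ − c.
⌊/φ⌋-rec : ∀ {N m p q} → ⌊ N /φ⌋≡ m → ⌊ suc m /φ⌋≡ p → q + p ≡ N → ⌊ suc N /φ⌋≡ q
⌊/φ⌋-rec {N} {m} {p} {q} f g q+p≡N with m≤n⇒∃[o]o+m≡n (a·φ<b⇒a<b (proj₁ f)) | ⌊/φ⌋-suc f
... | t , refl | inj₁ f₁ = subst ⌊ suc N /φ⌋≡_ (sym q≡m) f₁
  where
  p≡1+t : p ≡ suc t
  p≡1+t = ⌊/φ⌋-unique g (⌊·φ⌋-complement (proj₂ f₁ , ·φ<-+ 1·φ<2 (proj₁ f)))
  q≡m : q ≡ m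
  q≡m = +-cancelʳ-≡ (suc t) q m
    (trans (subst (λ x → q + x ≡ _) p≡1+t q+p≡N) (trans (+-suc t m) (+-comm (suc t) m)))
... | t , refl | inj₂ f₂ = subst ⌊ suc N /φ⌋≡_ (sym q≡1+m) f₂
  where
  p≡t : p ≡ t
  p≡t = ⌊/φ⌋-unique g (⌊·φ⌋-complement (proj₂ f , proj₁ f₂))
  q≡1+m : q ≡ suc m
  q≡1+m = +-cancelʳ-≡ t q (suc m) (trans (subst (λ x → q + x ≡ _) p≡t q+p≡N) (+-comm t (suc m)))

G≡⌊1+n/φ⌋ : ∀ G → IsHofstadterG G → ∀ n → ⌊ suc n /φ⌋≡ G n
G≡⌊1+n/φ⌋ G (G0 , G1 , G-rec) = <-rec (λ n → ⌊ suc n /φ⌋≡ G n) step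
  where
  step : ∀ n → (∀ {k} → k < n → ⌊ suc k /φ⌋≡ G k) → ⌊ suc n /φ⌋≡ G n
  step 0 _ rewrite G0 = 0·φ<1 , 1·φ>1
  step 1 _ rewrite G1 = 1·φ<2 , 2·φ>2
  step (suc (suc n)) ih = ⌊/φ⌋-rec G[1+n] (ih (a·φ<b⇒a<b (proj₁ G[1+n]))) (G-rec n)
    where
    G[1+n] : ⌊ suc (suc n) /φ⌋≡ G (suc n)
    G[1+n] = ih ≤-refl

x^2≡x*x : ∀ x → x ^ 2 ≡ x * x
x^2≡x*x x = cong (x *_) (*-identityʳ x)

private
  4[a²+a[d+a]] : ∀ a d → 4 * (a * a + a * (d + a)) ≡ 5 * (a * a) + (3 * (a * a) + 4 * (a * d))
  4[a²+a[d+a]] = solve-∀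

  4[d+a]² : ∀ a d → 4 * ((d + a) * (d + a)) ≡ (2 * d + a) * (2 * d + a) + (3 * (a * a) + 4 * (a * d))
  4[d+a]² = solve-∀

  2[d+a] : ∀ a d → 2 * (d + a) ≡ a + (2 * d + a)
  2[d+a] = solve-∀

  4N² : ∀ N → 4 * (N * N) ≡ (2 * N) * (2 * N)
  4N² = solve-∀

  4[k²+kN] : ∀ k N → 4 * (k * k + k * N) ≡ 4 * (k * k) + 2 * k * (2 * N)
  4[k²+kN] = solve-∀

  [e+k]² : ∀ k e → (e + k) * (e + k) ≡ e * e + (k * k + 2 * k * e)
  [e+k]² = solve-∀

  4k²+2k[e+k] : ∀ k e → 4 * (k * k) + 2 * k * (e + k) ≡ 5 * (k * k) + (k * k + 2 * k * e)
  4k²+2k[e+k] = solve-∀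

a·φ<c⇒LtNPhi : ∀ {a c} → a ·φ< c → LtNPhi a c
a·φ<c⇒LtNPhi {a} h@(mk·φ< a²+ac<c²) with m≤n⇒∃[o]o+m≡n (<⇒≤ (a·φ<b⇒a<b h))
... | d , refl rewrite x^2≡x*x a | 2[d+a] a d | m+n∸m≡n a (2 * d + a) | x^2≡x*x (2 * d + a) =
  +-cancelʳ-< (3 * (a * a) + 4 * (a * d)) _ _
    (subst₂ _<_ (4[a²+a[d+a]] a d) (4[d+a]² a d) (*-monoʳ-< 4 a²+ac<c²))

k·φ>N⇒LeNPhi : ∀ {k N} → k ·φ> N → LeNPhi k N
k·φ>N⇒LeNPhi {k} {N} (mk·φ> N²<k²+kN) with k ≤? 2 * N
... | no k≰2N rewrite m≤n⇒m∸n≡0 (<⇒≤ (≰⇒> k≰2N)) = z≤n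
... | yes k≤2N with 2 * N ∸ k | m∸n+n≡m k≤2N
...   | e | e+k≡2N rewrite x^2≡x*x e | x^2≡x*x k = <⇒≤ (+-cancelʳ-< (k * k + 2 * k * e) _ _
        (subst₂ _<_ ([e+k]² k e) (4k²+2k[e+k] k e) [e+k]²<4k²+2k[e+k]))
  where
  [e+k]²<4k²+2k[e+k] : (e + k) * (e + k) < 4 * (k * k) + 2 * k * (e + k)
  [e+k]²<4k²+2k[e+k] = subst (λ x → x * x < 4 * (k * k) + 2 * k * x) (sym e+k≡2N)
    (subst₂ _<_ (4N² N) (4[k²+kN] k N) (*-monoʳ-< 4 N²<k²+kN))

⌊·φ⌋⇒IsFloorNPhi : ∀ {c m} → ⌊ c ·φ⌋≡ m → IsFloorNPhi c m
⌊·φ⌋⇒IsFloorNPhi (c·> , c·<) = k·φ>N⇒LeNPhi c·> , a·φ<c⇒LtNPhi c·<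

[2a∸c]²≤x<[2[1+b]∸c]²⇒a≤b : ∀ c x a b → (2 * a ∸ c) ^ 2 ≤ x → x < (2 * suc b ∸ c) ^ 2 → a ≤ b
[2a∸c]²≤x<[2[1+b]∸c]²⇒a≤b c x a b h₁ h₂ with a ≤? b
... | yes a≤b = a≤b
... | no a≰b = contradiction (≤-<-trans h₁ h₂) (≤⇒≯ (^-monoˡ-≤ 2 (∸-monoˡ-≤ c (*-monoʳ-≤ 2 (≰⇒> a≰b)))))

IsFloorNPhi-unique : ∀ {k a b} → IsFloorNPhi k a → IsFloorNPhi k b → a ≡ b
IsFloorNPhi-unique {k} {a} {b} (a≤ , <1+a) (b≤ , <1+b) =
  ≤-antisym ([2a∸c]²≤x<[2[1+b]∸c]²⇒a≤b k _ a b a≤ <1+b) ([2a∸c]²≤x<[2[1+b]∸c]²⇒a≤b k _ b a b≤ <1+a)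

IsFloorNPhi²-unique : ∀ {k a b} → IsFloorNPhi² k a → IsFloorNPhi² k b → a ≡ b
IsFloorNPhi²-unique {k} {a} {b} (a≤ , <1+a) (b≤ , <1+b) =
  ≤-antisym ([2a∸c]²≤x<[2[1+b]∸c]²⇒a≤b (3 * k) _ a b a≤ <1+b) ([2a∸c]²≤x<[2[1+b]∸c]²⇒a≤b (3 * k) _ b a b≤ <1+a)

private
  3k≡2k+k : ∀ k → 3 * k ≡ 2 * k + k
  3k≡2k+k = solve-∀

2[k+x]∸3k≡2x∸k : ∀ k x → 2 * (k + x) ∸ 3 * k ≡ 2 * x ∸ k
2[k+x]∸3k≡2x∸k k x = begin
  2 * (k + x) ∸ 3 * k         ≡⟨ cong₂ _∸_ (*-distribˡ-+ 2 k x) (3k≡2k+k k) ⟩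
  (2 * k + 2 * x) ∸ (2 * k + k) ≡⟨ [m+n]∸[m+o]≡n∸o (2 * k) (2 * x) k ⟩
  2 * x ∸ k                   ∎
  where open ≡-Reasoning

IsFloorNPhi⇒IsFloorNPhi² : ∀ {k x} → IsFloorNPhi k x → IsFloorNPhi² k (k + x)
IsFloorNPhi⇒IsFloorNPhi² {k} {x} (x≤ , <1+x) =
  subst (λ y → y ^ 2 ≤ 5 * k ^ 2) (sym (2[k+x]∸3k≡2x∸k k x)) x≤ ,
  subst (λ y → 5 * k ^ 2 < (2 * y ∸ 3 * k) ^ 2) (+-suc k x)
    (subst (λ y → 5 * k ^ 2 < y ^ 2) (sym (2[k+x]∸3k≡2x∸k k (suc x))) <1+x)

module _ (L U W : ℕ → ℕ) (isL : IsLowerWythoff L) (isU : IsUpperWythoff U) (isW : IsWythoffSwap L U W) where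

  L≡⌊·φ⌋ : ∀ {j m} → ⌊ suc j ·φ⌋≡ m → L (suc j) ≡ m
  L≡⌊·φ⌋ {j} f = IsFloorNPhi-unique {suc j} (isL (suc j) (s≤s z≤n)) (⌊·φ⌋⇒IsFloorNPhi f)

  U≡1+j+⌊·φ⌋ : ∀ {j m} → ⌊ suc j ·φ⌋≡ m → U (suc j) ≡ suc j + m
  U≡1+j+⌊·φ⌋ {j} {m} f = IsFloorNPhi²-unique {suc j} (isU (suc j) (s≤s z≤n))
    (IsFloorNPhi⇒IsFloorNPhi² {suc j} {m} (⌊·φ⌋⇒IsFloorNPhi f))

  W-plateau : ∀ {n k} → ⌊ suc n /φ⌋≡ k → ⌊ suc (suc n) /φ⌋≡ k → W (suc n) ≡ k
  W-plateau {n} {k} f f′ with m≤n⇒∃[o]o+m≡n (s≤s⁻¹ (a·φ<b⇒a<b (proj₁ f)))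
  ... | o , refl = begin
    W (suc o + k)  ≡⟨ cong W (U≡1+j+⌊·φ⌋ ⌊1+o·φ⌋≡k) ⟨
    W (U (suc o))  ≡⟨ proj₂ (proj₂ isW (suc o) (s≤s z≤n)) ⟩
    L (suc o)      ≡⟨ L≡⌊·φ⌋ ⌊1+o·φ⌋≡k ⟩
    k              ∎
    where
    open ≡-Reasoning
    ⌊1+o·φ⌋≡k : ⌊ suc o ·φ⌋≡ k
    ⌊1+o·φ⌋≡k = c·φ<r+c⇒r·φ>c (proj₁ f)
              , c·φ>r+c⇒r·φ<c (subst (suc k ·φ>_) (sym (+-suc (suc o) k)) (proj₂ f′))

  W-rise : ∀ {n k} → ⌊ suc n /φ⌋≡ k → ⌊ suc (suc n) /φ⌋≡ suc k → W (suc n) ≡ suc k + suc n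
  W-rise {n} {k} f f′ = begin
    W (suc n)      ≡⟨ cong W (L≡⌊·φ⌋ ⌊1+k·φ⌋≡1+n) ⟨
    W (L (suc k))  ≡⟨ proj₁ (proj₂ isW (suc k) (s≤s z≤n)) ⟩
    U (suc k)      ≡⟨ U≡1+j+⌊·φ⌋ ⌊1+k·φ⌋≡1+n ⟩
    suc k + suc n  ∎
    where
    open ≡-Reasoning
    ⌊1+k·φ⌋≡1+n : ⌊ suc k ·φ⌋≡ suc n
    ⌊1+k·φ⌋≡1+n = proj₂ f , proj₁ f′

  W-mean-step : ∀ {n k k′} → ⌊ suc n /φ⌋≡ k → ⌊ suc (suc n) /φ⌋≡ k′
              → suc n * k + W (suc n) ≡ suc (suc n) * k′
  W-mean-step {n} {k} f f′ with ⌊/φ⌋-suc f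
  ... | inj₁ f₁ rewrite ⌊/φ⌋-unique f′ f₁ = trans (cong (suc n * k +_) (W-plateau f f₁)) (+-comm (suc n * k) k)
  ... | inj₂ f₂ rewrite ⌊/φ⌋-unique f′ f₂ = trans (cong (suc n * k +_) (W-rise f f₂)) (rise n k)
    where
    rise : ∀ n k → suc n * k + (suc k + suc n) ≡ suc (suc n) * suc k
    rise = solve-∀

theorem3 : (G L U W : ℕ → ℕ) → IsHofstadterG G → IsLowerWythoff L → IsUpperWythoff U
             → IsWythoffSwap L U W → ∀ n → sumTo W n ≡ suc n * G n
theorem3 G L U W isG isL isU isW zero = trans (proj₁ isW) (sym (trans (+-identityʳ (G 0)) (proj₁ isG)))
theorem3 G L U W isG isL isU isW (suc n) = begin
  sumTo W n + W (suc n)    ≡⟨ cong (_+ W (suc n)) (theorem3 G L U W isG isL isU isW n) ⟩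
  suc n * G n + W (suc n)  ≡⟨ W-mean-step L U W isL isU isW (G≡⌊1+n/φ⌋ G isG n) (G≡⌊1+n/φ⌋ G isG (suc n)) ⟩
  suc (suc n) * G (suc n)  ∎
  where open ≡-Reasoning
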